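{- Let $m\ge 1$ and let $n_1,\dots,n_m$ be even integers with $n_i\ge 4$. Let $\mathcal{C}=\mathcal{C}(C_{n_1},\dots,C_{n_m})$ be the chain cycle obtained from pairwise disjoint cycles $C_{n_1},\dots,C_{n_m}$, where $V(C_{n_i})=\{v^i_1,\dots,v^i_{n_i}\}$ with $v^i_j$ adjacent to $v^i_{j+1}$ ($1\le j<n_i$) and $v^i_{n_i}$ adjacent to $v^i_1$, by identifying the vertex $v^i_{\frac{n_i}{2}+1}$ with the vertex $v^{i+1}_1$ for each $i=1,\dots,m-1$. Then the partition dimension of $\mathcal{C}$ is $pd(\mathcal{C})=3$.
   Context: For a connected graph $G$ and an ordered partition $\Pi=\{Q_1,\dots,Q_k\}$ of $V(G)$, the representation of $v\in V(G)$ with respect to $\Pi$ is $r(v|\Pi)=(d(v,Q_1),\dots,d(v,Q_k))$, where $d(v,Q_i)=\min\{d(v,q): q\in Q_i\}$ and $d$ is the shortest-path distance. $\Pi$ is a resolving partition if $r(u|\Pi)\ne r(v|\Pi)$ for all distinct $u,v\in V(G)$. The partition dimension $pd(G)$ is the minimum $k$ for which $G$ has a resolving $k$-partition. -}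

module Defs where

open import Data.Nat using (ℕ; zero; suc; _≤_; _<_; _/_)
open import Data.Fin using (Fin; zero; suc; toℕ)
open import Data.Bool using (Bool; true; false; T)
open import Data.Product using (Σ; ∃; _×_; _,_; proj₁)
open import Data.Sum using (_⊎_)
open import Relation.Binary.PropositionalEquality using (_≡_)
open import Relation.Nullary using (¬_)

record Graph : Set₁ where
  field
    Vertex : Set
    Adj    : Vertex → Vertex → Set
open Graph public

module _ (G : Graph) where

  data Walk : Vertex G → Vertex G → ℕ → Set where
    here : ∀ {u} → Walk u u 0
    step : ∀ {u w v k} → Adj G u w → Walk w v k → Walk u v (suc k)

  Dist : Vertex G → Vertex G → ℕ → Set
  Dist u v k = Walk u v k × (∀ k' → Walk u v k' → k ≤ k')

  IsPartition : {k : ℕ} → (Vertex G → Fin k) → Set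
  IsPartition {k} f = ∀ (c : Fin k) → ∃ λ v → f v ≡ c

  DistToClass : {k : ℕ} → (Vertex G → Fin k) → Vertex G → Fin k → ℕ → Set
  DistToClass f u c d =
    (∃ λ q → f q ≡ c × Dist u q d) ×
    (∀ q d' → f q ≡ c → Dist u q d' → d ≤ d')

  SameRep : {k : ℕ} → (Vertex G → Fin k) → Vertex G → Vertex G → Set
  SameRep f u v = ∀ c d → (DistToClass f u c d → DistToClass f v c d)
                        × (DistToClass f v c d → DistToClass f u c d)

  Resolving : {k : ℕ} → (Vertex G → Fin k) → Set
  Resolving f = ∀ u v → ¬ u ≡ v → ¬ SameRep f u v

  ResolvingPartition : {k : ℕ} → (Vertex G → Fin k) → Set
  ResolvingPartition f = IsPartition f × Resolving f

  PartitionDimension : ℕ → Set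
  PartitionDimension k =
    (Σ (Vertex G → Fin k) ResolvingPartition) ×
    (∀ k' → k' < k → (f : Vertex G → Fin k') → ¬ ResolvingPartition f)

-- Chain cycle C(C_{n_1},…,C_{n_m}).
-- Cycles are indexed 0..m-1 and vertices 0..n_i-1 (0-based):
-- the pair (i , j) stands for v^{i+1}_{j+1} of the paper.

module _ {m : ℕ} (n : Fin m → ℕ) where

  DV : Set
  DV = Σ (Fin m) (λ i → Fin (n i))

  Succ : DV → DV → Set
  Succ (i , j) (i' , j') =
    toℕ i ≡ toℕ i' ×
    (toℕ j' ≡ suc (toℕ j) ⊎ (suc (toℕ j) ≡ n i × toℕ j' ≡ 0))

  CycAdj : DV → DV → Set
  CycAdj x y = Succ x y ⊎ Succ y x

  -- The identification v^{i}_{n_i/2+1} = v^{i+1}_1 is realised by taking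
  -- as canonical representative the vertex of the earlier cycle; the
  -- first vertex (j = 0) of each cycle other than the first is dropped.
  canon : DV → Bool
  canon (zero  , j) = true
  canon (suc i , j) with toℕ j
  ... | zero  = false
  ... | suc _ = true

  CV : Set
  CV = Σ DV (λ x → T (canon x))

  -- x (a vertex of the disjoint union) is glued onto y:
  -- x = v^{i'+1}_1 (0-based (i'+1,0)) and y = v^{i'}_{n_{i'}/2+1} (0-based (i', n_{i'}/2)).
  Glued : DV → DV → Set
  Glued (i , j) (i' , j') =
    toℕ i ≡ suc (toℕ i') × toℕ j ≡ 0 × toℕ j' ≡ n i' / 2

  Rep : DV → CV → Set
  Rep x u = proj₁ u ≡ x ⊎ Glued x (proj₁ u)

  CAdj : CV → CV → Set
  CAdj u v = ∃ λ x → ∃ λ y → Rep x u × Rep y v × CycAdj x y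

  ChainCycle : Graph
  ChainCycle = record { Vertex = CV ; Adj = CAdj }

module Submission where

open import Defs
open import Data.Nat using (ℕ; zero; suc; _+_; _∸_; _/_; _≤_; _<_; _≤?_; _<?_; z≤n; s≤s; z<s; s≤s⁻¹)
open import Data.Nat.Properties
open import Data.Nat.Divisibility using (_∣_)
open import Data.Nat.DivMod using (m*[n/m]≡n)
open import Data.Fin using (Fin; zero; suc; toℕ; fromℕ<; inject₁) renaming (_≟_ to _≟ᶠ_)
open import Data.Fin.Properties using (toℕ-fromℕ<; fromℕ<-toℕ; toℕ-inject₁; toℕ-injective; toℕ<n)
open import Data.Bool using (T)
open import Data.Bool.Properties using (T?; T-irrelevant)
open import Data.Unit using (tt)
open import Data.Product using (Σ; ∃; _×_; _,_; proj₁; proj₂)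
open import Data.Sum using (inj₁; inj₂)
open import Data.Empty using (⊥; ⊥-elim)
open import Relation.Binary.Definitions using (tri<; tri≈; tri>)
open import Relation.Binary.PropositionalEquality
open import Relation.Nullary using (¬_; Dec; yes; no; contradiction)
open import Relation.Nullary.Decidable using (¬?; decidable-stable)

-- pd of a chain of even cycles C_{n_1},…,C_{n_m} (n_i ≥ 4), cycle i+1 glued by its
-- first vertex onto position n_i/2 of cycle i, is 3.
-- Upper bound: the level of a vertex (cycle-distance to the first vertex of its cycle
-- plus the half lengths of all earlier cycles) changes by at most one along edges and
-- is realised by a walk to the root v¹₁, so it is the distance to the root (potential
-- argument).  Hence {root}, {first halves}, {second halves} is resolving: distance to
-- the singleton class {root} together with the class determines a vertex.
-- Lower bound: in a 2-partition all boundary vertices (with a neighbour in the other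
-- class) of one class share a representation, so a resolving 2-partition is constant
-- on every cycle of length ≥ 3, hence on the whole chain; one class separates nothing.

property-lost : (P : ℕ → Set) → ((x : ℕ) → Dec (P x)) → ∀ a b → a ≤ b → P a → ¬ P b →
                ∃ λ k → a ≤ k × k < b × P k × ¬ P (suc k)
property-lost P P? a zero z≤n pa ¬pb = ⊥-elim (¬pb pa)
property-lost P P? a (suc b) a≤1+b pa ¬pb with m≤n⇒m<n∨m≡n a≤1+b
... | inj₂ refl = ⊥-elim (¬pb pa)
... | inj₁ (s≤s a≤b) with P? b
...   | yes pb = b , a≤b , ≤-refl , pb , ¬pb
...   | no ¬pb′ with property-lost P P? a b a≤b pa ¬pb′
...     | k , a≤k , k<b , pk , ¬pk+1 = k , a≤k , m≤n⇒m≤1+n k<b , pk , ¬pk+1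

fin2-other : (a b c : Fin 2) → ¬ a ≡ c → ¬ b ≡ c → a ≡ b
fin2-other zero       zero       _          _   _   = refl
fin2-other (suc zero) (suc zero) _          _   _   = refl
fin2-other zero       (suc zero) zero       a≢c _   = ⊥-elim (a≢c refl)
fin2-other zero       (suc zero) (suc zero) _   b≢c = ⊥-elim (b≢c refl)
fin2-other (suc zero) zero       zero       _   b≢c = ⊥-elim (b≢c refl)
fin2-other (suc zero) zero       (suc zero) a≢c _   = ⊥-elim (a≢c refl)

module GraphFacts (G : Graph) where

  V : Set
  V = Vertex G

  _++ʷ_ : ∀ {u v w a b} → Walk G u v a → Walk G v w b → Walk G u w (a + b)
  here       ++ʷ w₂ = w₂
  step e w₁  ++ʷ w₂ = step e (w₁ ++ʷ w₂)

  walk-zero : ∀ {u v} → Walk G u v 0 → u ≡ v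
  walk-zero here = refl

  -- Potential argument: if h drops by at most one along every edge, every walk
  -- from u to v has length at least h u ∸ h v; so a walk from u to a zero of h
  -- of length h u is a shortest one.
  module Potential (h : V → ℕ) (h-lip : ∀ {u w} → Adj G u w → h u ≤ suc (h w)) where

    walk-potential : ∀ {u v k} → Walk G u v k → h u ≤ k + h v
    walk-potential here         = ≤-refl
    walk-potential (step e w)   = ≤-trans (h-lip e) (s≤s (walk-potential w))

    dist-potential : ∀ {u s} → h s ≡ 0 → Walk G u s (h u) → Dist G u s (h u)
    dist-potential {u} hs≡0 w = w , λ k w′ →
      subst (h u ≤_) (trans (cong (k +_) hs≡0) (+-identityʳ k)) (walk-potential w′)

  module Path (P : ℕ → V) (N : ℕ) (path-adj : ∀ x → x < N → Adj G (P x) (P (suc x))) where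

    walk-to-end : ∀ k a → a + k ≡ N → Walk G (P a) (P N) k
    walk-to-end zero    a a+0≡N   = subst (λ z → Walk G (P a) (P z) 0) (trans (sym (+-identityʳ a)) a+0≡N) here
    walk-to-end (suc k) a a+k+1≡N = step (path-adj a (subst (a <_) a+k+1≡N (m<m+n a z<s)))
                                         (walk-to-end k (suc a) (trans (sym (+-suc a k)) a+k+1≡N))

    module _ (adj-sym : ∀ {u w} → Adj G u w → Adj G w u) where

      walk-backward : ∀ k → k ≤ N → Walk G (P k) (P 0) k
      walk-backward zero    _     = here
      walk-backward (suc k) k<N   = step (adj-sym (path-adj k k<N)) (walk-backward k (<⇒≤ k<N))

  module Classes {k : ℕ} (f : V → Fin k) where

    class-dist-unique : ∀ {u c a b} → DistToClass G f u c a → DistToClass G f u c b → a ≡ b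
    class-dist-unique ((qa , fqa , da) , min-a) ((qb , fqb , db) , min-b) =
      ≤-antisym (min-a qb _ fqb db) (min-b qa _ fqa da)

    same-rep : ∀ {u v} → (∀ c → ∃ λ d → DistToClass G f u c d × DistToClass G f v c d) → SameRep G f u v
    same-rep {u} {v} common c d with common c
    ... | d₀ , du , dv =
      (λ du′ → subst (DistToClass G f v c) (class-dist-unique du du′) dv) ,
      (λ dv′ → subst (DistToClass G f u c) (class-dist-unique dv dv′) du)

    class-dist-own : ∀ {u c} → f u ≡ c → DistToClass G f u c 0
    class-dist-own {u} fu≡c = (u , fu≡c , (here , λ _ _ → z≤n)) , λ _ _ _ _ → z≤n

    class-dist-own⁻¹ : ∀ {u c} → DistToClass G f u c 0 → f u ≡ c
    class-dist-own⁻¹ ((q , fq≡c , (w , _)) , _) = trans (cong f (walk-zero w)) fq≡c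

    class-dist-adj : ∀ {u p c} → Adj G u p → f p ≡ c → ¬ f u ≡ c → DistToClass G f u c 1
    class-dist-adj {u} {p} {c} u~p fp≡c fu≢c = (p , fp≡c , (step u~p here , at-least-1)) , at-least-1′
      where
      at-least-1 : ∀ k → Walk G u p k → 1 ≤ k
      at-least-1 zero    w = ⊥-elim (fu≢c (trans (cong f (walk-zero w)) fp≡c))
      at-least-1 (suc _) _ = s≤s z≤n
      at-least-1′ : ∀ q d → f q ≡ c → Dist G u q d → 1 ≤ d
      at-least-1′ q zero    fq≡c (w , _) = ⊥-elim (fu≢c (trans (cong f (walk-zero w)) fq≡c))
      at-least-1′ q (suc _) _    _       = s≤s z≤n

    singleton-class-resolving : (s : V) → (∀ q → f q ≡ f s → q ≡ s) →
      (h : V → ℕ) → (∀ u → Dist G u s (h u)) →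
      (∀ u v → h u ≡ h v → f u ≡ f v → u ≡ v) → Resolving G f
    singleton-class-resolving s only-s h dist separates u v u≢v same =
      u≢v (separates u v (class-dist-unique dist-v-from-u (dist-to-s v)) same-class)
      where
      dist-to-s : ∀ w → DistToClass G f w (f s) (h w)
      dist-to-s w = (s , refl , dist w) , λ q d fq≡fs (walk , _) →
        proj₂ (dist w) d (subst (λ z → Walk G w z d) (only-s q fq≡fs) walk)
      dist-v-from-u : DistToClass G f v (f s) (h u)
      dist-v-from-u = proj₁ (same (f s) (h u)) (dist-to-s u)
      same-class : f u ≡ f v
      same-class = sym (class-dist-own⁻¹ (proj₁ (same (f u) 0) (class-dist-own refl)))

  one-class-same-rep : (f : V → Fin 1) → ∀ u v → SameRep G f u v
  one-class-same-rep f u v = same-rep λ { zero → 0 , class-dist-own (only-class u) , class-dist-own (only-class v) }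
    where
    open Classes f
    only-class : ∀ w → f w ≡ zero
    only-class w with f w
    ... | zero = refl

  Boundary : {k : ℕ} → (V → Fin k) → V → Set
  Boundary f u = ∃ λ p → Adj G u p × ¬ f p ≡ f u

  -- In a 2-partition all boundary vertices of one class have representation (0,1) or (1,0),
  -- so a resolving 2-partition has at most one boundary vertex in each class.
  boundary-unique : (f : V → Fin 2) → Resolving G f → ∀ {u v} → ¬ u ≡ v → f u ≡ f v →
                    Boundary f u → Boundary f v → ⊥
  boundary-unique f resolving {u} {v} u≢v fu≡fv (p , u~p , fp≢fu) (q , v~q , fq≢fv) =
    resolving u v u≢v (same-rep common)
    where
    open Classes f
    common : ∀ c → ∃ λ d → DistToClass G f u c d × DistToClass G f v c d
    common c with c ≟ᶠ f u
    ... | yes c≡fu = 0 , class-dist-own (sym c≡fu) , class-dist-own (trans (sym fu≡fv) (sym c≡fu))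
    ... | no  c≢fu = 1 , class-dist-adj u~p (fin2-other _ _ _ fp≢fu c≢fu) (λ e → c≢fu (sym e))
                       , class-dist-adj v~q (fin2-other _ _ _ fq≢fv (λ e → c≢fu (trans e (sym fu≡fv))))
                                       (λ e → c≢fu (trans (sym e) (sym fu≡fv)))

  -- A resolving 2-partition is constant on every cycle P 0, P 1, …, P N = P 0 of
  -- length N ≥ 3: if the class of P 0 were left at some step j → j+1 and
  -- re-entered at a step k → k+1, then P (j+1) and P k (or, when k = j+1, the
  -- vertices P j and P (j+2)) would be two distinct boundary vertices of one class.
  module Cycle (adj-sym : ∀ {u w} → Adj G u w → Adj G w u)
               (f : V → Fin 2) (resolving : Resolving G f)
               (N : ℕ) (3≤N : 3 ≤ N) (P : ℕ → V) (closed : P N ≡ P 0)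
               (cyc-adj : ∀ x → x < N → Adj G (P x) (P (suc x)))
               (cyc-inj : ∀ x y → x < N → y < N → P x ≡ P y → x ≡ y) where

    InStartClass : ℕ → Set
    InStartClass y = f (P y) ≡ f (P 0)

    in-start-class? : ∀ y → Dec (InStartClass y)
    in-start-class? y = f (P y) ≟ᶠ f (P 0)

    distant-return : ∀ j k → j < N → suc j < k → k < N →
      InStartClass j → ¬ InStartClass (suc j) → ¬ InStartClass k → InStartClass (suc k) → ⊥
    distant-return j k j<N j+1<k k<N in-j out-j+1 out-k in-k+1 =
      boundary-unique f resolving distinct (fin2-other _ _ _ out-j+1 out-k)
        (P j , adj-sym (cyc-adj j j<N) , λ e → out-j+1 (trans (sym e) in-j))
        (P (suc k) , cyc-adj k k<N , λ e → out-k (trans (sym e) in-k+1))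
      where
      distinct : ¬ P (suc j) ≡ P k
      distinct e = <-irrefl (cyc-inj (suc j) k (<-trans j+1<k k<N) k<N e) j+1<k

    immediate-return : ∀ j → suc j < N →
      InStartClass j → ¬ InStartClass (suc j) → InStartClass (suc (suc j)) → ⊥
    immediate-return j j+1<N in-j out-j+1 in-j+2 =
      boundary-unique f resolving (distinct (suc (suc j) <? N)) (trans in-j (sym in-j+2))
        (P (suc j) , cyc-adj j j<N , λ e → out-j+1 (trans e in-j))
        (P (suc j) , adj-sym (cyc-adj (suc j) j+1<N) , λ e → out-j+1 (trans e in-j+2))
      where
      j<N : j < N
      j<N = <-trans (n<1+n j) j+1<N
      distinct : Dec (suc (suc j) < N) → ¬ P j ≡ P (suc (suc j))
      distinct (yes j+2<N) e = m≢1+m+n j (trans (cyc-inj j _ j<N j+2<N e) (cong suc (+-comm 1 j)))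
      distinct (no  j+2≮N) e = <-irrefl (sym N≡2) (≤-trans (s≤s (s≤s (s≤s z≤n))) 3≤N)
        where
        j+2≡N : suc (suc j) ≡ N
        j+2≡N = ≤-antisym j+1<N (≮⇒≥ j+2≮N)
        j≡0 : j ≡ 0
        j≡0 = cyc-inj j 0 j<N (<-trans (s≤s z≤n) j+1<N) (trans e (trans (cong P j+2≡N) closed))
        N≡2 : N ≡ 2
        N≡2 = trans (sym j+2≡N) (cong (λ z → suc (suc z)) j≡0)

    cycle-monochromatic : ∀ x → x < N → f (P x) ≡ f (P 0)
    cycle-monochromatic x x<N with in-start-class? x
    ... | yes in-x = in-x
    ... | no out-x
      with property-lost InStartClass in-start-class? 0 x z≤n refl out-x
    ... | j , _ , j<x , in-j , out-j+1
      with property-lost (λ y → ¬ InStartClass y) (λ y → ¬? (in-start-class? y)) (suc j) N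
             (<-trans j<x x<N) out-j+1 (λ out-N → out-N (cong f closed))
    ... | k , j+1≤k , k<N , out-k , not-out-k+1
      with m≤n⇒m<n∨m≡n j+1≤k | decidable-stable (in-start-class? (suc k)) not-out-k+1
    ... | inj₁ j+1<k | in-k+1 = ⊥-elim (distant-return j k (<-trans j<x x<N) j+1<k k<N in-j out-j+1 out-k in-k+1)
    ... | inj₂ refl  | in-k+1 = ⊥-elim (immediate-return j k<N in-j out-j+1 in-k+1)

-- Distance from position a to position 0 on a cycle with N = 2t positions.
cycle-dist : (N t a : ℕ) → ℕ
cycle-dist N t a with a ≤? t
... | yes _ = a
... | no  _ = N ∸ a

half-class : (t a : ℕ) → Fin 3
half-class t a with a <? t
... | yes _ = suc zero
... | no  _ = suc (suc zero)

half-class-< : ∀ {t a} → a < t → half-class t a ≡ suc zero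
half-class-< {t} {a} a<t with a <? t
... | yes _   = refl
... | no  a≮t = contradiction a<t a≮t

half-class-≥ : ∀ {t a} → ¬ a < t → half-class t a ≡ suc (suc zero)
half-class-≥ {t} {a} a≮t with a <? t
... | yes a<t = contradiction a<t a≮t
... | no  _   = refl

class-at : (i a h : ℕ) → Fin 3
class-at zero    zero    _ = zero
class-at zero    (suc a) h = half-class h (suc a)
class-at (suc i) a       h = half-class h a

half-class-nonzero : ∀ h a → ¬ half-class h a ≡ zero
half-class-nonzero h a with a <? h
... | yes _ = λ ()
... | no  _ = λ ()

class-at-root : ∀ i a h → class-at i a h ≡ zero → i ≡ 0 × a ≡ 0
class-at-root zero    zero    h _ = refl , refl
class-at-root zero    (suc a) h e = contradiction e (half-class-nonzero h (suc a))
class-at-root (suc i) a       h e = contradiction e (half-class-nonzero h a)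

class-at-half : ∀ i a h → ¬ class-at i a h ≡ zero → class-at i a h ≡ half-class h a
class-at-half zero    zero    h not-root = contradiction refl not-root
class-at-half zero    (suc a) h _        = refl
class-at-half (suc i) a       h _        = refl

∸-pred : ∀ {N a} → suc a ≤ N → N ∸ a ≡ suc (N ∸ suc a)
∸-pred {N} a<N = +-∸-assoc 1 a<N

module CycleDist {N t : ℕ} (N≡t+t : N ≡ t + t) where

  dist : ℕ → ℕ
  dist = cycle-dist N t

  dist-≤ : ∀ {a} → a ≤ t → dist a ≡ a
  dist-≤ {a} a≤t with a ≤? t
  ... | yes _   = refl
  ... | no  a≰t = contradiction a≤t a≰t

  dist-> : ∀ {a} → ¬ a ≤ t → dist a ≡ N ∸ a
  dist-> {a} a≰t with a ≤? t
  ... | yes a≤t = contradiction a≤t a≰t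
  ... | no  _   = refl

  N∸t≡t : N ∸ t ≡ t
  N∸t≡t = trans (cong (_∸ t) N≡t+t) (m+n∸n≡m t t)

  dist-0 : dist 0 ≡ 0
  dist-0 = dist-≤ z≤n

  dist-t : dist t ≡ t
  dist-t = dist-≤ ≤-refl

  dist-bounded : ∀ a → dist a ≤ t
  dist-bounded a with a ≤? t
  ... | yes a≤t = a≤t
  ... | no  a≰t = subst (N ∸ a ≤_) N∸t≡t (∸-monoʳ-≤ N (<⇒≤ (≰⇒> a≰t)))

  dist-positive : ∀ {a} → 1 ≤ a → a < N → 1 ≤ dist a
  dist-positive {a} 1≤a a<N with a ≤? t
  ... | yes _ = 1≤a
  ... | no  _ = m<n⇒0<n∸m a<N

  dist-step : ∀ a → suc a < N → dist a ≤ suc (dist (suc a)) × dist (suc a) ≤ suc (dist a)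
  dist-step a a+1<N with a ≤? t | suc a ≤? t
  ... | yes _   | yes _     = m≤n⇒m≤1+n (n≤1+n a) , ≤-refl
  ... | no  a≰t | yes a+1≤t = contradiction (≤-trans (n≤1+n a) a+1≤t) a≰t
  ... | no  _   | no  _     = ≤-reflexive (∸-pred (<⇒≤ a+1<N)) ,
                              m≤n⇒m≤1+n (subst (N ∸ suc a ≤_) (sym (∸-pred (<⇒≤ a+1<N))) (n≤1+n _))
  ... | yes a≤t | no  a+1≰t = ≤-reflexive a≡1+rest , ≤-trans (n≤1+n _) (≤-trans (≤-reflexive (sym a≡1+rest)) (n≤1+n a))
    where
    a≡t : a ≡ t
    a≡t = ≤-antisym a≤t (s≤s⁻¹ (≰⇒> a+1≰t))
    a≡1+rest : a ≡ suc (N ∸ suc a)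
    a≡1+rest = trans a≡t (trans (sym N∸t≡t) (trans (cong (N ∸_) (sym a≡t)) (∸-pred (<⇒≤ a+1<N))))

  dist-last : ∀ a → suc a ≡ N → dist a ≤ 1
  dist-last a a+1≡N with a ≤? t
  ... | no  _   = ≤-reflexive (trans (cong (_∸ a) (sym a+1≡N)) (m+n∸n≡m 1 a))
  ... | yes a≤t = ≤-trans a≤t (+-cancelˡ-≤ t t 1 t+t≤t+1)
    where
    t+t≤t+1 : t + t ≤ t + 1
    t+t≤t+1 = subst₂ _≤_ (trans a+1≡N N≡t+t) (+-comm 1 t) (s≤s a≤t)

  opposite-halves : ∀ {a b} → a ≤ t → ¬ b ≤ t → b < N → dist a ≡ dist b → ¬ half-class t a ≡ half-class t b
  opposite-halves {a} {b} a≤t b≰t b<N same-dist same-half =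
    contradiction (trans (sym (half-class-< a<t)) (trans same-half (half-class-≥ (λ b<t → b≰t (<⇒≤ b<t))))) λ ()
    where
    a≡N∸b : a ≡ N ∸ b
    a≡N∸b = trans (sym (dist-≤ a≤t)) (trans same-dist (dist-> b≰t))
    a<t : a < t
    a<t = subst (_< t) (sym a≡N∸b) (subst (N ∸ b <_) N∸t≡t (∸-monoʳ-< (≰⇒> b≰t) (<⇒≤ b<N)))

  dist-half-injective : ∀ {a b} → a < N → b < N → dist a ≡ dist b → half-class t a ≡ half-class t b → a ≡ b
  dist-half-injective {a} {b} a<N b<N same-dist same-half = by-halves (a ≤? t) (b ≤? t)
    where
    by-halves : Dec (a ≤ t) → Dec (b ≤ t) → a ≡ b
    by-halves (yes a≤t) (yes b≤t) = trans (sym (dist-≤ a≤t)) (trans same-dist (dist-≤ b≤t))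
    by-halves (yes a≤t) (no  b≰t) = ⊥-elim (opposite-halves a≤t b≰t b<N same-dist same-half)
    by-halves (no  a≰t) (yes b≤t) = ⊥-elim (opposite-halves b≤t a≰t a<N (sym same-dist) (sym same-half))
    by-halves (no  a≰t) (no  b≰t) =
      ∸-cancelˡ-≡ (<⇒≤ a<N) (<⇒≤ b<N) (trans (sym (dist-> a≰t)) (trans same-dist (dist-> b≰t)))

prefix-sum : (ℕ → ℕ) → ℕ → ℕ
prefix-sum g zero    = 0
prefix-sum g (suc k) = prefix-sum g k + g k

prefix-sum-mono : ∀ g {a b} → a ≤ b → prefix-sum g a ≤ prefix-sum g b
prefix-sum-mono g {a} {zero}  z≤n    = ≤-refl
prefix-sum-mono g {a} {suc b} a≤1+b with m≤n⇒m<n∨m≡n a≤1+b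
... | inj₁ (s≤s a≤b) = ≤-trans (prefix-sum-mono g a≤b) (m≤m+n _ _)
... | inj₂ refl      = ≤-refl

module ChainCycleFacts (m′ : ℕ) (n : Fin (suc m′) → ℕ)
                       (n-even : ∀ i → 2 ∣ n i) (4≤n : ∀ i → 4 ≤ n i) where

  G : Graph
  G = ChainCycle n
  open GraphFacts G

  -- Half length of each cycle: cycle i+1 is glued at position t i of cycle i.
  t : Fin (suc m′) → ℕ
  t i = n i / 2

  n≡t+t : ∀ i → n i ≡ t i + t i
  n≡t+t i = trans (sym (m*[n/m]≡n (n-even i))) (cong (t i +_) (+-identityʳ (t i)))

  2≤t : ∀ i → 2 ≤ t i
  2≤t i with t i ≤? 1
  ... | no  t≰1 = ≰⇒> t≰1
  ... | yes t≤1 = contradiction (≤-trans (subst (4 ≤_) (n≡t+t i) (4≤n i)) (+-mono-≤ t≤1 t≤1)) λ { (s≤s (s≤s ())) }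

  t<n : ∀ i → t i < n i
  t<n i = subst (t i <_) (sym (n≡t+t i)) (m<m+n (t i) (≤-trans (s≤s z≤n) (2≤t i)))

  module OnCycle (i : Fin (suc m′)) = CycleDist {n i} {t i} (n≡t+t i)

  0<n : ∀ i → 0 < n i
  0<n i = ≤-trans (s≤s z≤n) (4≤n i)

  vtx : (i : Fin (suc m′)) (a : ℕ) → a < n i → DV n
  vtx i a a<n = i , fromℕ< a<n

  attach : Fin m′ → DV n
  attach i = vtx (inject₁ i) (t (inject₁ i)) (t<n (inject₁ i))

  canonical-if-positive : ∀ x → 0 < toℕ (proj₂ x) → T (canon n x)
  canonical-if-positive (zero  , j) _ = tt
  canonical-if-positive (suc i , j) 0<j with toℕ j
  ... | suc _ = tt

  canonical-positive : ∀ i j → T (canon n (suc i , j)) → 0 < toℕ j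
  canonical-positive i j c with toℕ j
  ... | suc _ = s≤s z≤n

  attach-canonical : ∀ i → T (canon n (attach i))
  attach-canonical i = canonical-if-positive (attach i)
    (subst (0 <_) (sym (toℕ-fromℕ< (t<n (inject₁ i)))) (≤-trans (s≤s z≤n) (2≤t _)))

  toCV : DV n → CV n
  toCV (zero  , j) = (zero , j) , tt
  toCV (suc i , j) with T? (canon n (suc i , j))
  ... | yes c = (suc i , j) , c
  ... | no  _ = attach i , attach-canonical i

  toCV-canonical : ∀ x (c : T (canon n x)) → toCV x ≡ (x , c)
  toCV-canonical (zero  , j) tt = refl
  toCV-canonical (suc i , j) c with T? (canon n (suc i , j))
  ... | yes c′ = cong ((suc i , j) ,_) (T-irrelevant c′ c)
  ... | no  ¬c = contradiction c ¬c

  noncanonical-start : ∀ i j → ¬ T (canon n (suc i , j)) → toℕ j ≡ 0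
  noncanonical-start i j ¬c = n≤0⇒n≡0 (≮⇒≥ (λ 0<j → ¬c (canonical-if-positive (suc i , j) 0<j)))

  toCV-rep : ∀ x → Rep n x (toCV x)
  toCV-rep (zero  , j) = inj₁ refl
  toCV-rep (suc i , j) with T? (canon n (suc i , j))
  ... | yes _  = inj₁ refl
  ... | no  ¬c = inj₂ (cong suc (sym (toℕ-inject₁ i)) , noncanonical-start i j ¬c , toℕ-fromℕ< (t<n (inject₁ i)))

  toCV-glued : ∀ i j → toℕ j ≡ 0 → toCV (suc i , j) ≡ toCV (attach i)
  toCV-glued i j j≡0 with T? (canon n (suc i , j))
  ... | yes c = contradiction (subst (0 <_) j≡0 (canonical-positive i j c)) λ ()
  ... | no  _ = sym (toCV-canonical (attach i) (attach-canonical i))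

  cv-≡ : ∀ {u v : CV n} → proj₁ u ≡ proj₁ v → u ≡ v
  cv-≡ {x , c} {.x , c′} refl = cong (x ,_) (T-irrelevant c c′)

  dv-≡ : ∀ {i i′} (a : Fin (n i)) (b : Fin (n i′)) → toℕ i ≡ toℕ i′ → toℕ a ≡ toℕ b → (i , a) ≡ (i′ , b)
  dv-≡ {i} {i′} a b i≡i′ a≡b with toℕ-injective {i = i} {j = i′} i≡i′
  ... | refl = cong (i ,_) (toℕ-injective a≡b)

  rep-position-unique : ∀ x y u → Rep n x u → Rep n y u → toℕ (proj₁ x) ≡ toℕ (proj₁ y) → toℕ (proj₂ x) ≡ toℕ (proj₂ y)
  rep-position-unique x y u (inj₁ refl) (inj₁ refl) _ = refl
  rep-position-unique x y u (inj₁ refl) (inj₂ (y-glued , _ , _)) x≡y = contradiction (sym (trans x≡y y-glued)) 1+n≢n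
  rep-position-unique x y u (inj₂ (x-glued , _ , _)) (inj₁ refl) x≡y = contradiction (sym (trans (sym x≡y) x-glued)) 1+n≢n
  rep-position-unique x y u (inj₂ (_ , x≡0 , _)) (inj₂ (_ , y≡0 , _)) _ = trans x≡0 (sym y≡0)

  chain-adj-sym : ∀ {u w} → CAdj n u w → CAdj n w u
  chain-adj-sym (x , y , x∈u , y∈w , inj₁ x→y) = y , x , y∈w , x∈u , inj₂ x→y
  chain-adj-sym (x , y , x∈u , y∈w , inj₂ y→x) = y , x , y∈w , x∈u , inj₁ y→x

  cycle-edge : ∀ x y → CycAdj n x y → CAdj n (toCV x) (toCV y)
  cycle-edge x y x~y = x , y , toCV-rep x , toCV-rep y , x~y

  -- Cycle i traversed from its first position: P i x is position x, and P i (n i) = P i 0.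
  P : Fin (suc m′) → ℕ → CV n
  P i x with x <? n i
  ... | yes x<n = toCV (vtx i x x<n)
  ... | no  _   = toCV (vtx i 0 (0<n i))

  P-vtx : ∀ i x (x<n : x < n i) → P i x ≡ toCV (vtx i x x<n)
  P-vtx i x x<n with x <? n i
  ... | yes _   = refl
  ... | no  x≮n = contradiction x<n x≮n

  P-closed : ∀ i → P i (n i) ≡ P i 0
  P-closed i with n i <? n i
  ... | yes n<n = contradiction n<n (<-irrefl refl)
  ... | no  _   = sym (P-vtx i 0 (0<n i))

  P-adj : ∀ i x → x < n i → CAdj n (P i x) (P i (suc x))
  P-adj i x x<n = subst (λ z → CAdj n z (P i (suc x))) (sym (P-vtx i x x<n)) (step-to (suc x <? n i))
    where
    step-to : Dec (suc x < n i) → CAdj n (toCV (vtx i x x<n)) (P i (suc x))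
    step-to (yes x+1<n) = subst (CAdj n (toCV (vtx i x x<n))) (sym (P-vtx i (suc x) x+1<n))
      (cycle-edge _ _ (inj₁ (refl , inj₁ (trans (toℕ-fromℕ< x+1<n) (cong suc (sym (toℕ-fromℕ< x<n)))))))
    step-to (no x+1≮n) = subst (CAdj n (toCV (vtx i x x<n))) (sym (trans (cong (P i) x+1≡n) (trans (P-closed i) (P-vtx i 0 (0<n i)))))
      (cycle-edge _ _ (inj₁ (refl , inj₂ (trans (cong suc (toℕ-fromℕ< x<n)) x+1≡n , toℕ-fromℕ< (0<n i)))))
      where
      x+1≡n : suc x ≡ n i
      x+1≡n = ≤-antisym x<n (≮⇒≥ x+1≮n)

  P-injective : ∀ i x y → x < n i → y < n i → P i x ≡ P i y → x ≡ y
  P-injective i x y x<n y<n Px≡Py = begin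
      x                         ≡⟨ toℕ-fromℕ< x<n ⟨
      toℕ (fromℕ< x<n)          ≡⟨ rep-position-unique (vtx i x x<n) (vtx i y y<n) (toCV (vtx i y y<n)) x∈u (toCV-rep _) refl ⟩
      toℕ (fromℕ< y<n)          ≡⟨ toℕ-fromℕ< y<n ⟩
      y                         ∎
    where
    open ≡-Reasoning
    x∈u : Rep n (vtx i x x<n) (toCV (vtx i y y<n))
    x∈u = subst (Rep n (vtx i x x<n)) (trans (sym (P-vtx i x x<n)) (trans Px≡Py (P-vtx i y y<n))) (toCV-rep _)

  P-position : ∀ i (j : Fin (n i)) c → P i (toℕ j) ≡ ((i , j) , c)
  P-position i j c = trans (P-vtx i (toℕ j) (toℕ<n j))
    (trans (cong (λ z → toCV (i , z)) (fromℕ<-toℕ j (toℕ<n j))) (toCV-canonical (i , j) c))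

  P-glue : ∀ i → P (suc i) 0 ≡ P (inject₁ i) (t (inject₁ i))
  P-glue i = trans (P-vtx (suc i) 0 (0<n _))
    (trans (toCV-glued i _ (toℕ-fromℕ< (0<n (suc i)))) (sym (P-vtx (inject₁ i) _ (t<n _))))

  -- Half length of the k-th cycle, indexed by ℕ (0 past the last cycle).
  tℕ : ℕ → ℕ
  tℕ k with k <? suc m′
  ... | yes k<M = t (fromℕ< k<M)
  ... | no  _   = 0

  tℕ-toℕ : ∀ i → tℕ (toℕ i) ≡ t i
  tℕ-toℕ i with toℕ i <? suc m′
  ... | yes i<M = cong t (fromℕ<-toℕ i i<M)
  ... | no  i≮M = contradiction (toℕ<n i) i≮M

  -- Distance from the first vertex of cycle k to the root v¹₁: the sum of the half lengths before it.
  offset : ℕ → ℕ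
  offset = prefix-sum tℕ

  offset-suc : ∀ i → offset (suc (toℕ i)) ≡ t i + offset (toℕ i)
  offset-suc i = trans (cong (offset (toℕ i) +_) (tℕ-toℕ i)) (+-comm _ (t i))

  -- The level of a vertex: its distance to the root (established below).
  level-DV : DV n → ℕ
  level-DV (i , j) = cycle-dist (n i) (t i) (toℕ j) + offset (toℕ i)

  level : CV n → ℕ
  level u = level-DV (proj₁ u)

  level-rep : ∀ x u → Rep n x u → level u ≡ level-DV x
  level-rep x u (inj₁ refl) = refl
  level-rep (i , j) ((i′ , j′) , _) (inj₂ (i≡i′+1 , j≡0 , j′≡t)) = begin
      cycle-dist (n i′) (t i′) (toℕ j′) + offset (toℕ i′)  ≡⟨ cong (_+ offset (toℕ i′)) (trans (cong (cycle-dist (n i′) (t i′)) j′≡t) (OnCycle.dist-t i′)) ⟩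
      t i′ + offset (toℕ i′)                                ≡⟨ offset-suc i′ ⟨
      offset (suc (toℕ i′))                                 ≡⟨ cong offset i≡i′+1 ⟨
      offset (toℕ i)                                        ≡⟨ cong (_+ offset (toℕ i)) (trans (cong (cycle-dist (n i) (t i)) j≡0) (OnCycle.dist-0 i)) ⟨
      cycle-dist (n i) (t i) (toℕ j) + offset (toℕ i)       ∎
    where
    open ≡-Reasoning

  succ-level : ∀ x y → Succ n x y → level-DV x ≤ suc (level-DV y) × level-DV y ≤ suc (level-DV x)
  succ-level (i , a) (i′ , b) (i≡i′ , _) with toℕ-injective {i = i} {j = i′} i≡i′
  succ-level (i , a) (.i , b) (_ , inj₁ b≡a+1) | refl =
    +-monoˡ-≤ H (subst (λ z → dist (toℕ a) ≤ suc (dist z)) (sym b≡a+1) (proj₁ neighbours)) ,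
    +-monoˡ-≤ H (subst (λ z → dist z ≤ suc (dist (toℕ a))) (sym b≡a+1) (proj₂ neighbours))
    where
    open OnCycle i
    H : ℕ
    H = offset (toℕ i)
    neighbours : dist (toℕ a) ≤ suc (dist (suc (toℕ a))) × dist (suc (toℕ a)) ≤ suc (dist (toℕ a))
    neighbours = dist-step (toℕ a) (subst (_< n i) b≡a+1 (toℕ<n b))
  succ-level (i , a) (.i , b) (_ , inj₂ (a+1≡n , b≡0)) | refl =
    +-monoˡ-≤ H (≤-trans (dist-last (toℕ a) a+1≡n) (s≤s (≤-reflexive (sym dist-b≡0)))) ,
    +-monoˡ-≤ H (≤-trans (≤-reflexive dist-b≡0) z≤n)
    where
    open OnCycle i
    H : ℕ
    H = offset (toℕ i)
    dist-b≡0 : dist (toℕ b) ≡ 0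
    dist-b≡0 = trans (cong dist b≡0) dist-0

  level-lipschitz : ∀ {u w} → CAdj n u w → level u ≤ suc (level w)
  level-lipschitz {u} {w} (x , y , x∈u , y∈w , x~y) =
    subst₂ (λ p q → p ≤ suc q) (sym (level-rep x u x∈u)) (sym (level-rep y w y∈w)) (cycle-step x~y)
    where
    cycle-step : CycAdj n x y → level-DV x ≤ suc (level-DV y)
    cycle-step (inj₁ x→y) = proj₁ (succ-level x y x→y)
    cycle-step (inj₂ y→x) = proj₂ (succ-level y x y→x)

  walk-to-start : ∀ i a → a < n i → Walk G (P i a) (P i 0) (cycle-dist (n i) (t i) a)
  walk-to-start i a a<n with a ≤? t i
  ... | yes _ = walk-backward (λ {u} {w} → chain-adj-sym {u} {w}) a (<⇒≤ a<n)
    where open Path (P i) (n i) (P-adj i)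
  ... | no  _ = subst (λ z → Walk G (P i a) z (n i ∸ a)) (P-closed i) (walk-to-end (n i ∸ a) a (m+[n∸m]≡n (<⇒≤ a<n)))
    where open Path (P i) (n i) (P-adj i)

  root : CV n
  root = toCV (vtx zero 0 (0<n zero))

  walk-start-to-root : ∀ k i → toℕ i ≡ k → Walk G (P i 0) root (offset k)
  walk-start-to-root zero    zero    _      = subst (λ z → Walk G z root 0) (sym (P-vtx zero 0 (0<n zero))) here
  walk-start-to-root (suc k) (suc i) i+1≡k+1 =
    subst (λ z → Walk G z root (offset (suc k))) (sym (P-glue i))
      (subst (Walk G _ root) length (walk-to-start i′ (t i′) (t<n i′) ++ʷ walk-start-to-root k i′ i′≡k))
    where
    i′ : Fin (suc m′)
    i′ = inject₁ i
    i′≡k : toℕ i′ ≡ k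
    i′≡k = trans (toℕ-inject₁ i) (suc-injective i+1≡k+1)
    length : cycle-dist (n i′) (t i′) (t i′) + offset k ≡ offset (suc k)
    length = begin
        cycle-dist (n i′) (t i′) (t i′) + offset k  ≡⟨ cong (_+ offset k) (OnCycle.dist-t i′) ⟩
        t i′ + offset k                             ≡⟨ cong (λ z → t i′ + offset z) i′≡k ⟨
        t i′ + offset (toℕ i′)                      ≡⟨ offset-suc i′ ⟨
        offset (suc (toℕ i′))                       ≡⟨ cong (λ z → offset (suc z)) i′≡k ⟩
        offset (suc k)                              ∎
      where open ≡-Reasoning

  walk-to-root : ∀ u → Walk G u root (level u)
  walk-to-root ((i , j) , c) = subst (λ z → Walk G z root (level-DV (i , j))) (P-position i j c)
    (walk-to-start i (toℕ j) (toℕ<n j) ++ʷ walk-start-to-root (toℕ i) i refl)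

  level-root : level root ≡ 0
  level-root = trans (+-identityʳ _) (trans (cong (cycle-dist (n zero) (t zero)) (toℕ-fromℕ< (0<n zero))) (OnCycle.dist-0 zero))

  dist-to-root : ∀ u → Dist G u root (level u)
  dist-to-root u = Potential.dist-potential level (λ {u} {w} → level-lipschitz {u} {w}) level-root (walk-to-root u)

  level-cross : ∀ {i i′} (a : Fin (n i)) (b : Fin (n i′)) → toℕ i < toℕ i′ → T (canon n (i′ , b)) →
                level-DV (i , a) < level-DV (i′ , b)
  level-cross {i} {suc i′} a b i<i′ c = begin-strict
      cycle-dist (n i) (t i) (toℕ a) + offset (toℕ i)   ≤⟨ +-monoˡ-≤ _ (OnCycle.dist-bounded i (toℕ a)) ⟩
      t i + offset (toℕ i)                              ≡⟨ offset-suc i ⟨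
      offset (suc (toℕ i))                              ≤⟨ prefix-sum-mono tℕ i<i′ ⟩
      offset (toℕ (suc i′))                             <⟨ +-monoˡ-< _ (OnCycle.dist-positive (suc i′) (canonical-positive i′ b c) (toℕ<n b)) ⟩
      cycle-dist (n (suc i′)) (t (suc i′)) (toℕ b) + offset (toℕ (suc i′)) ∎
    where open ≤-Reasoning

  classOf : CV n → Fin 3
  classOf ((i , j) , _) = class-at (toℕ i) (toℕ j) (t i)

  root-class : classOf root ≡ zero
  root-class = cong (λ a → class-at 0 a (t zero)) (toℕ-fromℕ< (0<n zero))

  only-root : ∀ u → classOf u ≡ zero → u ≡ root
  only-root ((i , j) , _) e with class-at-root (toℕ i) (toℕ j) (t i) e
  ... | i≡0 , j≡0 = cv-≡ (dv-≡ j (fromℕ< (0<n zero)) i≡0 (trans j≡0 (sym (toℕ-fromℕ< (0<n zero)))))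

  level-class-separate : ∀ u v → level u ≡ level v → classOf u ≡ classOf v → u ≡ v
  level-class-separate u v same-level same-class with classOf u ≟ᶠ zero
  ... | yes u-root = trans (only-root u u-root) (sym (only-root v (trans (sym same-class) u-root)))
  level-class-separate ((i , a) , c) ((i′ , b) , c′) same-level same-class | no not-root
    with <-cmp (toℕ i) (toℕ i′)
  ... | tri< i<i′ _ _ = contradiction same-level (<⇒≢ (level-cross a b i<i′ c′))
  ... | tri> _ _ i′<i = contradiction (sym same-level) (<⇒≢ (level-cross b a i′<i c))
  ... | tri≈ _ i≡i′ _ with toℕ-injective {i = i} {j = i′} i≡i′
  ... | refl = cv-≡ (cong (i ,_) (toℕ-injective (OnCycle.dist-half-injective i (toℕ<n a) (toℕ<n b)
                 (+-cancelʳ-≡ (offset (toℕ i)) _ _ same-level) same-half)))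
    where
    same-half : half-class (t i) (toℕ a) ≡ half-class (t i) (toℕ b)
    same-half = trans (sym (class-at-half (toℕ i) (toℕ a) (t i) not-root))
                  (trans same-class (class-at-half (toℕ i) (toℕ b) (t i) (λ e → not-root (trans same-class e))))

  classOf-partition : IsPartition G classOf
  classOf-partition zero                = root , root-class
  classOf-partition (suc zero)          = toCV (vtx zero 1 1<n) ,
    trans (cong (λ a → class-at 0 a (t zero)) (toℕ-fromℕ< 1<n)) (half-class-< (2≤t zero))
    where
    1<n : 1 < n zero
    1<n = ≤-trans (s≤s (s≤s z≤n)) (4≤n zero)
  classOf-partition (suc (suc zero))    = toCV (vtx zero (t zero) (t<n zero)) ,
    trans (cong (λ a → class-at 0 a (t zero)) (toℕ-fromℕ< (t<n zero)))
      (trans (class-at-half 0 (t zero) (t zero) (λ e → contradiction (proj₂ (class-at-root 0 _ _ e)) t≢0))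
             (half-class-≥ (<-irrefl refl)))
    where
    t≢0 : ¬ t zero ≡ 0
    t≢0 e = contradiction (subst (2 ≤_) e (2≤t zero)) λ ()

  resolving-3-partition : Σ (CV n → Fin 3) (ResolvingPartition G)
  resolving-3-partition = classOf , classOf-partition ,
    Classes.singleton-class-resolving classOf root
      (λ q e → only-root q (trans e root-class)) level dist-to-root level-class-separate

  -- A resolving 2-partition is constant: it is constant on each cycle, and
  -- consecutive cycles share a vertex.
  two-classes-constant : (f : CV n → Fin 2) → Resolving G f → ∀ u → f u ≡ f (P zero 0)
  two-classes-constant f resolving ((i , j) , c) = begin
      f ((i , j) , c)      ≡⟨ cong f (P-position i j c) ⟨
      f (P i (toℕ j))      ≡⟨ on-cycle i (toℕ j) (toℕ<n j) ⟩
      f (P i 0)            ≡⟨ start-class (toℕ i) i refl ⟩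
      f (P zero 0)         ∎
    where
    open ≡-Reasoning
    on-cycle : ∀ i x → x < n i → f (P i x) ≡ f (P i 0)
    on-cycle i = Cycle.cycle-monochromatic (λ {u} {w} → chain-adj-sym {u} {w}) f resolving
                   (n i) (≤-trans (n≤1+n 3) (4≤n i)) (P i) (P-closed i) (P-adj i) (P-injective i)
    start-class : ∀ k i → toℕ i ≡ k → f (P i 0) ≡ f (P zero 0)
    start-class zero    zero    _        = refl
    start-class (suc k) (suc i) i+1≡k+1 = begin
        f (P (suc i) 0)              ≡⟨ cong f (P-glue i) ⟩
        f (P i′ (t i′))              ≡⟨ on-cycle i′ (t i′) (t<n i′) ⟩
        f (P i′ 0)                   ≡⟨ start-class k i′ (trans (toℕ-inject₁ i) (suc-injective i+1≡k+1)) ⟩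
        f (P zero 0)                 ∎
      where
      i′ : Fin (suc m′)
      i′ = inject₁ i

  no-small-resolving-partition : ∀ k → k < 3 → (f : CV n → Fin k) → ¬ ResolvingPartition G f
  no-small-resolving-partition zero _ f _ with f root
  ... | ()
  no-small-resolving-partition (suc zero) _ f (_ , resolving) =
    resolving (P zero 0) (P zero 1) (λ e → 0≢1+n (P-injective zero 0 1 (0<n zero) 1<n e)) (one-class-same-rep f _ _)
    where
    1<n : 1 < n zero
    1<n = ≤-trans (s≤s (s≤s z≤n)) (4≤n zero)
  no-small-resolving-partition (suc (suc zero)) _ f (partition , resolving)
    with partition zero | partition (suc zero)
  ... | v₀ , fv₀≡0 | v₁ , fv₁≡1 = contradiction 0≡1 λ ()
    where
    constant : ∀ u → f u ≡ f (P zero 0)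
    constant = two-classes-constant f resolving
    0≡1 : zero ≡ suc zero
    0≡1 = trans (sym fv₀≡0) (trans (constant v₀) (trans (sym (constant v₁)) fv₁≡1))
  no-small-resolving-partition (suc (suc (suc _))) (s≤s (s≤s (s≤s ())))

theorem2p3 : (m : ℕ) → 1 ≤ m → (n : Fin m → ℕ) →
    (∀ i → 2 ∣ n i) → (∀ i → 4 ≤ n i) →
    PartitionDimension (ChainCycle n) 3
theorem2p3 zero    ()
theorem2p3 (suc m′) _ n n-even 4≤n = resolving-3-partition , no-small-resolving-partition
  where open ChainCycleFacts m′ n n-even 4≤n
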